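{- Let $(G,r,k,c,\pi)$ be a $k$-PCST instance satisfying the standing assumptions below, with optimal value $\mathrm{OPT}$. Run the algorithm $\mathcal{A}$ described below on it. If $\mathcal{A}$ terminates at Step 3, then its output $F_{\rm OUT}=(V_{\rm OUT},E_{\rm OUT})$ is a feasible solution of the $k$-PCST instance and satisfies \[\sum_{e\in E_{\rm OUT}}c(e)+\sum_{v\notin V_{\rm OUT}}\pi(v)\le 4\,\mathrm{OPT}.\]
   Context: $k$-PCST: given an undirected connected graph $G=(V,E)$, a root $r\in V$, an integer $k\le|V|$, $c:E\to\mathbb{R}_+$ and $\pi:V\to\mathbb{R}_+$, find a subtree $F=(V_F,E_F)$ with $r\in V_F$, $|V_F|\ge k$, minimizing $\sum_{e\in E_F}c(e)+\sum_{v\notin V_F}\pi(v)$; minimum value $\mathrm{OPT}$. Rooted PCST $(G,r,c,\pi)$: same without the constraint $|V_F|\ge k$; optimal value $\mathrm{OPT}_{\rm PCST}$. Rooted $k$-MST $(G,r,k,c)$: subtree containing $r$ with at least $k$ vertices minimizing $\sum_{e\in E_F}c(e)$; optimal value $\mathrm{OPT}_{k\text{ -MST}}$. Standing assumptions: $G$ complete; $c$ satisfies the triangle inequality; $c(\{r,v\})<\mathrm{OPT}_{\rm PCST}$ for all $v\in V$; $\min_{e\in E}c(e)<\mathrm{OPT}$. Procedure 1 is the Goemans–Williamson primal–dual algorithm for rooted PCST, which returns a subtree $F=(V_F,E_F)$ containing $r$ with $\sum_{e\in E_F}c(e)+\sum_{v\notin V_F}\pi(v)\le 2\,\mathrm{OPT}_{\rm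 PCST}$. Procedure 2 is Garg's 2-approximation algorithm for rooted $k$-MST, which returns a subtree containing $r$ with exactly $k$ vertices and edge cost at most $2\,\mathrm{OPT}_{k\text{ -MST}}$. Algorithm $\mathcal{A}$: Step 1: apply Procedure 1 to $(G,r,c,\pi)$, obtaining $F_{\rm PCST}=(V_{\rm PCST},E_{\rm PCST})$; if $|V_{\rm PCST}|\ge k$, output $F_{\rm OUT}=F_{\rm PCST}$ and stop. Step 2: otherwise apply Procedure 2 to $(G,r,k,c)$, obtaining $F_{k\text{ -MST}}=(V_{k\text{ -MST}},E_{k\text{ -MST}})$. Step 3: form the graph $G'=(V_{\rm PCST}\cup V_{k\text{ -MST}},E_{\rm PCST}\cup E_{k\text{ -MST}})$, compute a minimum spanning tree $F_{\rm OUT}=(V_{\rm OUT},E_{\rm OUT})$ of $G'$ with respect to $c$, and output it.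
   Formalization: The edge costs c and penalties π take values in the nonnegative rationals instead of $\mathbb{R}_+$, and the optimal values OPT, $\mathrm{OPT}_{\rm PCST}$ and $\mathrm{OPT}_{k\text{ -MST}}$ are rational. -}

module Defs where

open import Data.Nat as ℕ using (ℕ; suc)
open import Data.Fin as Fin using (Fin)
open import Data.Fin.Subset using (Subset; _∈_; _∉_; ∣_∣; _∪_)
open import Data.Fin.Subset.Properties using (_∈?_)
open import Data.Rational as ℚ using (ℚ; 0ℚ; _+_; _*_; _≤_; _<_; normalize)
open import Data.List using (List; []; _∷_; map; foldr; length)
open import Data.List.Relation.Unary.All using (All)
open import Data.List.Relation.Unary.Unique.Propositional using (Unique)
open import Data.List.Membership.Propositional using () renaming (_∈_ to _∈ₗ_)
open import Data.Product using (Σ; _×_; _,_; proj₁; proj₂; ∃)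
open import Data.Sum using (_⊎_)
open import Relation.Nullary using (does; ¬_)
open import Relation.Binary.PropositionalEquality using (_≡_; _≢_)
open import Data.Bool using (if_then_else_)

-- The complete graph on the vertex set Fin n.  An edge {u,v} (u ≠ v) is
-- represented canonically as the ordered pair (u , v) with u < v.
Edge : ℕ → Set
Edge n = Fin n × Fin n

Cost : ℕ → Set
Cost n = Fin n → Fin n → ℚ

two four : ℚ
two  = normalize 2 1
four = normalize 4 1

sumFin : ∀ {n} → (Fin n → ℚ) → ℚ
sumFin {ℕ.zero} f = 0ℚ
sumFin {suc n}  f = f Fin.zero + sumFin (λ i → f (Fin.suc i))

edgeCost : ∀ {n} → Cost n → List (Edge n) → ℚ
edgeCost c E = foldr _+_ 0ℚ (map (λ e → c (proj₁ e) (proj₂ e)) E)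

penalty : ∀ {n} → (Fin n → ℚ) → Subset n → ℚ
penalty π V = sumFin (λ v → if does (v ∈? V) then 0ℚ else π v)

objective : ∀ {n} → Cost n → (Fin n → ℚ) → Subset n → List (Edge n) → ℚ
objective c π V E = edgeCost c E + penalty π V

Adj : ∀ {n} → List (Edge n) → Fin n → Fin n → Set
Adj E u w = ((u , w) ∈ₗ E) ⊎ ((w , u) ∈ₗ E)

data Reach {n} (E : List (Edge n)) (r : Fin n) : Fin n → Set where
  here : Reach E r r
  step : ∀ {u w} → Reach E r u → Adj E u w → Reach E r w

-- (V , E) is a subtree of the complete graph on Fin n containing r:
-- E is a set of (canonically ordered) edges with endpoints in V, the
-- graph (V , E) is connected, and |E| = |V| - 1 (so it is acyclic, i.e. a tree).
record IsSubtree {n} (r : Fin n) (V : Subset n) (E : List (Edge n)) : Set where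
  field
    root∈     : r ∈ V
    canonical : All (λ e → proj₁ e Fin.< proj₂ e) E
    endpoints : All (λ e → (proj₁ e ∈ V) × (proj₂ e ∈ V)) E
    noDup     : Unique E
    connected : ∀ v → v ∈ V → Reach E r v
    size      : suc (length E) ≡ ∣ V ∣

IsMinOver : ∀ {n} → (Subset n → List (Edge n) → Set) →
            (Subset n → List (Edge n) → ℚ) → ℚ → Set
IsMinOver {n} P f x =
  (Σ (Subset n) λ V → Σ (List (Edge n)) λ E → P V E × f V E ≡ x) ×
  (∀ V E → P V E → x ≤ f V E)

kPCSTFeasible : ∀ {n} → Fin n → ℕ → Subset n → List (Edge n) → Set
kPCSTFeasible r k V E = IsSubtree r V E × (k ℕ.≤ ∣ V ∣)

IsOPT-kPCST : ∀ {n} → Fin n → ℕ → Cost n → (Fin n → ℚ) → ℚ → Set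
IsOPT-kPCST r k c π = IsMinOver (kPCSTFeasible r k) (objective c π)

IsOPT-PCST : ∀ {n} → Fin n → Cost n → (Fin n → ℚ) → ℚ → Set
IsOPT-PCST r c π = IsMinOver (IsSubtree r) (objective c π)

IsOPT-kMST : ∀ {n} → Fin n → ℕ → Cost n → ℚ → Set
IsOPT-kMST r k c = IsMinOver (kPCSTFeasible r k) (λ V E → edgeCost c E)

ValidCost : ∀ {n} → Cost n → Set
ValidCost {n} c =
  (∀ (u v : Fin n) → u ≢ v → c u v ≡ c v u) ×
  (∀ (u v : Fin n) → u ≢ v → 0ℚ ≤ c u v)

TriangleIneq : ∀ {n} → Cost n → Set
TriangleIneq {n} c = ∀ (u v w : Fin n) → u ≢ v → v ≢ w → u ≢ w →
  c u w ≤ c u v + c v w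

ValidPenalty : ∀ {n} → (Fin n → ℚ) → Set
ValidPenalty π = ∀ v → 0ℚ ≤ π v

-- Output of Procedure 1 (Goemans–Williamson): a subtree containing r whose
-- PCST objective is at most 2·OPT_PCST.
Proc1Output : ∀ {n} → Fin n → Cost n → (Fin n → ℚ) → ℚ → Subset n → List (Edge n) → Set
Proc1Output r c π optPCST V E = IsSubtree r V E × (objective c π V E ≤ two * optPCST)

-- Output of Procedure 2 (Garg): a subtree containing r with exactly k vertices
-- and edge cost at most 2·OPT_{k-MST}.
Proc2Output : ∀ {n} → Fin n → ℕ → Cost n → ℚ → Subset n → List (Edge n) → Set
Proc2Output r k c optkMST V E =
  IsSubtree r V E × (∣ V ∣ ≡ k) × (edgeCost c E ≤ two * optkMST)

IsSpanningTreeOf : ∀ {n} → Fin n → Subset n → List (Edge n) → List (Edge n) →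
                   List (Edge n) → Set
IsSpanningTreeOf r V' E₁ E₂ E =
  IsSubtree r V' E × All (λ e → (e ∈ₗ E₁) ⊎ (e ∈ₗ E₂)) E

IsMSTOf : ∀ {n} → Fin n → Cost n → Subset n → List (Edge n) → List (Edge n) →
          List (Edge n) → Set
IsMSTOf r c V' E₁ E₂ E =
  IsSpanningTreeOf r V' E₁ E₂ E ×
  (∀ E' → IsSpanningTreeOf r V' E₁ E₂ E' → edgeCost c E ≤ edgeCost c E')

{-# OPTIONS --safe #-}
-- The edges of F_OUT are distinct edges of E_PCST ∪ E_kMST and costs are
-- nonnegative, so c(E_OUT) ≤ c(E_PCST) + c(E_kMST); since V_OUT ⊇ V_PCST, the
-- penalty of F_OUT is at most that of F_PCST.  Hence the objective of F_OUT is
-- at most 2·OPT_PCST + 2·OPT_kMST.  An optimal k-PCST tree is feasible for PCST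
-- and, penalties being nonnegative, costs no more than OPT as a k-MST, so both
-- optima are ≤ OPT.  Feasibility holds because V_OUT ⊇ V_kMST.
module Submission where

open import Defs
open import Data.Nat as ℕ using (ℕ; _≤_; _<_)
open import Data.Fin as Fin using (Fin)
open import Data.Fin.Properties using (<⇒≢)
open import Data.Fin.Subset using (Subset; ∣_∣; _∪_; _⊆_)
open import Data.Fin.Subset.Properties using (_∈?_; p⊆p∪q; ∣q∣≤∣p∪q∣)
open import Data.Rational using (ℚ; 0ℚ; _+_)
  renaming (_≤_ to _≤ℚ_; _<_ to _<ℚ_; _*_ to _*ℚ_)
open import Data.Rational.Properties
  using ( ≤-refl; ≤-reflexive; ≤-trans; module ≤-Reasoning; +-identityˡ; +-identityʳ; +-assoc
        ; +-mono-≤; +-monoʳ-≤; +-0-commutativeMonoid; *-monoˡ-≤-nonNeg; *-distribʳ-+ )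
open import Data.List using (List; []; _∷_; _++_; map; foldr)
open import Data.List.Membership.Propositional using (_∈_; _─_)
open import Data.List.Membership.Propositional.Properties using (∈-++⁺ˡ; ∈-++⁺ʳ)
open import Data.List.Relation.Unary.All as All using (All; []; _∷_)
open import Data.List.Relation.Unary.All.Properties using (─⁺; ++⁺)
open import Data.List.Relation.Unary.Any using (here; there)
open import Data.List.Relation.Unary.AllPairs using (_∷_)
open import Data.List.Relation.Unary.Unique.Propositional using (Unique)
open import Data.Product using (Σ; _×_; _,_; proj₁; proj₂)
open import Data.Sum using ([_,_])
open import Data.Bool using (if_then_else_)
open import Function using (_∘_)
open import Relation.Nullary using (does; yes; no; contradiction)
open import Relation.Binary.PropositionalEquality
  using (_≡_; _≢_; refl; sym; trans; cong; subst)
open import Algebra.Bundles using (module CommutativeMonoid)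
open import Algebra.Properties.CommutativeSemigroup
  (CommutativeMonoid.commutativeSemigroup +-0-commutativeMonoid) using (x∙yz≈y∙xz; xy∙z≈xz∙y)

∈-─⁺ : ∀ {X : Set} {x y : X} {xs} (x∈xs : x ∈ xs) → x ≢ y → y ∈ xs → y ∈ xs ─ x∈xs
∈-─⁺ (here refl) x≢y (here refl) = contradiction refl x≢y
∈-─⁺ (here refl) x≢y (there y∈xs) = y∈xs
∈-─⁺ (there x∈xs) x≢y (here refl) = here refl
∈-─⁺ (there x∈xs) x≢y (there y∈xs) = there (∈-─⁺ x∈xs x≢y y∈xs)

p≤p+q : ∀ p {q} → 0ℚ ≤ℚ q → p ≤ℚ p + q
p≤p+q p 0≤q = subst (_≤ℚ p + _) (+-identityʳ p) (+-monoʳ-≤ p 0≤q)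

sumBy : ∀ {X : Set} → (X → ℚ) → List X → ℚ
sumBy f xs = foldr _+_ 0ℚ (map f xs)

module _ {X : Set} (f : X → ℚ) where

  sumBy-nonneg : ∀ {xs} → All (λ x → 0ℚ ≤ℚ f x) xs → 0ℚ ≤ℚ sumBy f xs
  sumBy-nonneg []             = ≤-refl
  sumBy-nonneg (0≤fx ∷ 0≤fxs) = +-mono-≤ 0≤fx (sumBy-nonneg 0≤fxs)

  sumBy-++ : ∀ xs ys → sumBy f (xs ++ ys) ≡ sumBy f xs + sumBy f ys
  sumBy-++ []       ys = sym (+-identityˡ (sumBy f ys))
  sumBy-++ (x ∷ xs) ys =
    trans (cong (f x +_) (sumBy-++ xs ys)) (sym (+-assoc (f x) _ _))

  sumBy-─ : ∀ {x xs} (x∈xs : x ∈ xs) → sumBy f xs ≡ f x + sumBy f (xs ─ x∈xs)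
  sumBy-─ (here refl) = refl
  sumBy-─ {x} {y ∷ xs} (there x∈xs) =
    trans (cong (f y +_) (sumBy-─ x∈xs)) (x∙yz≈y∙xz (f y) (f x) _)

  sumBy-mono-⊆ : ∀ {xs ys} → Unique xs → All (_∈ ys) xs →
                 All (λ y → 0ℚ ≤ℚ f y) ys → sumBy f xs ≤ℚ sumBy f ys
  sumBy-mono-⊆ {[]} _ _ 0≤fys = sumBy-nonneg 0≤fys
  sumBy-mono-⊆ {x ∷ xs} {ys} (x∉xs ∷ uniq) (x∈ys ∷ xs⊆ys) 0≤fys = begin
    f x + sumBy f xs              ≤⟨ +-monoʳ-≤ (f x) (sumBy-mono-⊆ uniq xs⊆ys─x (─⁺ x∈ys 0≤fys)) ⟩
    f x + sumBy f (ys ─ x∈ys)     ≡⟨ sym (sumBy-─ x∈ys) ⟩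
    sumBy f ys                    ∎
    where
    open ≤-Reasoning
    xs⊆ys─x : All (_∈ ys ─ x∈ys) xs
    xs⊆ys─x = All.zipWith (λ (x≢y , y∈ys) → ∈-─⁺ x∈ys x≢y y∈ys) (x∉xs , xs⊆ys)

edgeWeight : ∀ {n} → Cost n → Edge n → ℚ
edgeWeight c (u , v) = c u v

edgeWeight-nonneg : ∀ {n} {c : Cost n} {E : List (Edge n)} → ValidCost c →
                    All (λ e → proj₁ e Fin.< proj₂ e) E →
                    All (λ e → 0ℚ ≤ℚ edgeWeight c e) E
edgeWeight-nonneg (_ , nonneg) = All.map (λ u<v → nonneg _ _ (<⇒≢ u<v))

spanningTree-edgeCost≤ : ∀ {n} {r : Fin n} {c : Cost n} {V₁ V₂ V E₁ E₂ E} →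
  ValidCost c → IsSubtree r V₁ E₁ → IsSubtree r V₂ E₂ → IsSpanningTreeOf r V E₁ E₂ E →
  edgeCost c E ≤ℚ edgeCost c E₁ + edgeCost c E₂
spanningTree-edgeCost≤ {c = c} {E₁ = E₁} {E₂} {E} valid T₁ T₂ (T , E⊆E₁∪E₂) =
  subst (edgeCost c E ≤ℚ_) (sumBy-++ (edgeWeight c) E₁ E₂)
    (sumBy-mono-⊆ (edgeWeight c) (IsSubtree.noDup T)
      (All.map [ ∈-++⁺ˡ , ∈-++⁺ʳ E₁ ] E⊆E₁∪E₂)
      (++⁺ (edgeWeight-nonneg valid (IsSubtree.canonical T₁))
           (edgeWeight-nonneg valid (IsSubtree.canonical T₂))))

sumFin-nonneg : ∀ {n} {f : Fin n → ℚ} → (∀ i → 0ℚ ≤ℚ f i) → 0ℚ ≤ℚ sumFin f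
sumFin-nonneg {ℕ.zero} 0≤f = ≤-refl
sumFin-nonneg {ℕ.suc n} 0≤f = +-mono-≤ (0≤f Fin.zero) (sumFin-nonneg (0≤f ∘ Fin.suc))

sumFin-mono : ∀ {n} {f g : Fin n → ℚ} → (∀ i → f i ≤ℚ g i) → sumFin f ≤ℚ sumFin g
sumFin-mono {ℕ.zero} f≤g = ≤-refl
sumFin-mono {ℕ.suc n} f≤g = +-mono-≤ (f≤g Fin.zero) (sumFin-mono (f≤g ∘ Fin.suc))

module _ {n} {π : Fin n → ℚ} (0≤π : ValidPenalty π) where

  penalty-nonneg : ∀ V → 0ℚ ≤ℚ penalty π V
  penalty-nonneg V = sumFin-nonneg pointwise
    where
    pointwise : ∀ v → 0ℚ ≤ℚ (if does (v ∈? V) then 0ℚ else π v)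
    pointwise v with v ∈? V
    ... | yes _ = ≤-refl
    ... | no  _ = 0≤π v

  penalty-antitone : ∀ {V W} → V ⊆ W → penalty π W ≤ℚ penalty π V
  penalty-antitone {V} {W} V⊆W = sumFin-mono pointwise
    where
    pointwise : ∀ v → (if does (v ∈? W) then 0ℚ else π v) ≤ℚ (if does (v ∈? V) then 0ℚ else π v)
    pointwise v with v ∈? W | v ∈? V
    ... | yes _   | yes _   = ≤-refl
    ... | yes _   | no  _   = 0≤π v
    ... | no  v∉W | yes v∈V = contradiction (V⊆W v∈V) v∉W
    ... | no  _   | no  _   = ≤-refl

module _ {n} {r : Fin n} {k : ℕ} {c : Cost n} {π : Fin n → ℚ} {OPT : ℚ} where

  OPT-PCST≤OPT-kPCST : ∀ {OPTpcst} → IsOPT-kPCST r k c π OPT → IsOPT-PCST r c π OPTpcst →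
                       OPTpcst ≤ℚ OPT
  OPT-PCST≤OPT-kPCST ((V , E , (T , _) , obj≡OPT) , _) (_ , pcst-min) =
    subst (_ ≤ℚ_) obj≡OPT (pcst-min V E T)

  OPT-kMST≤OPT-kPCST : ∀ {OPTkmst} → ValidPenalty π →
                       IsOPT-kPCST r k c π OPT → IsOPT-kMST r k c OPTkmst → OPTkmst ≤ℚ OPT
  OPT-kMST≤OPT-kPCST 0≤π ((V , E , feasible , obj≡OPT) , _) (_ , kmst-min) =
    subst (_ ≤ℚ_) obj≡OPT
      (≤-trans (kmst-min V E feasible) (p≤p+q (edgeCost c E) (penalty-nonneg 0≤π V)))

two*p+two*q≤four*r : ∀ {p q r} → p ≤ℚ r → q ≤ℚ r → two *ℚ p + two *ℚ q ≤ℚ four *ℚ r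
two*p+two*q≤four*r {r = r} p≤r q≤r =
  -- (two + two) *ℚ r computes to four *ℚ r
  ≤-trans (+-mono-≤ (*-monoˡ-≤-nonNeg two p≤r) (*-monoˡ-≤-nonNeg two q≤r))
          (≤-reflexive (sym (*-distribʳ-+ r two two)))

theorem2 : ∀ (n : ℕ) (r : Fin n) (k : ℕ) (c : Cost n) (π : Fin n → ℚ)
    (OPT OPTpcst OPTkmst : ℚ) →
    k ≤ n → ValidCost c → ValidPenalty π → TriangleIneq c →
    IsOPT-kPCST r k c π OPT → IsOPT-PCST r c π OPTpcst → IsOPT-kMST r k c OPTkmst →
    (∀ v → v ≢ r → c r v <ℚ OPTpcst) →
    Σ (Fin n) (λ u → Σ (Fin n) (λ v → (u ≢ v) × (c u v <ℚ OPT))) →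
    ∀ (Vpcst : Subset n) (Epcst : List (Edge n)) →
    Proc1Output r c π OPTpcst Vpcst Epcst →
    ∣ Vpcst ∣ < k →
    ∀ (Vkmst : Subset n) (Ekmst : List (Edge n)) →
    Proc2Output r k c OPTkmst Vkmst Ekmst →
    ∀ (Eout : List (Edge n)) →
    IsMSTOf r c (Vpcst ∪ Vkmst) Epcst Ekmst Eout →
    kPCSTFeasible r k (Vpcst ∪ Vkmst) Eout ×
    (objective c π (Vpcst ∪ Vkmst) Eout ≤ℚ four *ℚ OPT)
theorem2 n r k c π OPT OPTpcst OPTkmst _ valid 0≤π _ opt optPCST optKMST _ _
  Vp Ep (Tp , objp≤) _ Vk Ek (Tk , ∣Vk∣≡k , costk≤) Eout (spanning , _) =
  (proj₁ spanning , subst (_≤ ∣ Vp ∪ Vk ∣) ∣Vk∣≡k (∣q∣≤∣p∪q∣ Vp Vk)) , objective≤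
  where
  open ≤-Reasoning
  objective≤ : objective c π (Vp ∪ Vk) Eout ≤ℚ four *ℚ OPT
  objective≤ = begin
    edgeCost c Eout + penalty π (Vp ∪ Vk)
      ≤⟨ +-mono-≤ (spanningTree-edgeCost≤ valid Tp Tk spanning)
                  (penalty-antitone 0≤π (p⊆p∪q Vk)) ⟩
    (edgeCost c Ep + edgeCost c Ek) + penalty π Vp
      ≡⟨ xy∙z≈xz∙y (edgeCost c Ep) (edgeCost c Ek) (penalty π Vp) ⟩
    objective c π Vp Ep + edgeCost c Ek
      ≤⟨ +-mono-≤ objp≤ costk≤ ⟩
    two *ℚ OPTpcst + two *ℚ OPTkmst
      ≤⟨ two*p+two*q≤four*r (OPT-PCST≤OPT-kPCST opt optPCST)
                            (OPT-kMST≤OPT-kPCST 0≤π opt optKMST) ⟩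
    four *ℚ OPT ∎
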